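{- Let $K$ be a field of characteristic $0$ and $p$ a prime. Suppose $f\colon\mathbb N\to K$ has a representation \[ f(p^i m) = g(i)\, m^r \chi(m) \qquad\text{for all } i \ge 0,\ m\in\mathbb N,\ p\nmid m, \] where $g\colon\mathbb Z_{\ge 0}\to K$ is a linear recurrence sequence with $g(0)=1$, $r\ge 0$ is an integer, and $\chi\colon\mathbb N\to K$ is multiplicative and eventually periodic. (1) If $f \neq 0$, then $g$ is uniquely determined by $f$ (i.e. it is the same in every such representation of $f$ with this prime $p$). (2) If $f(n)\neq 0$ for infinitely many $n$ with $p\nmid n$, and $\chi$ is chosen such that $\chi(n)=0$ whenever $p\mid n$, then $r$ and $\chi$ are also uniquely determined by $f$.
   Context: A function $\chi\colon \mathbb N \to K$ is multiplicative if $\chi(mn)=\chi(m)\chi(n)$ whenever $m,n$ are coprime. A linear recurrence sequence is a sequence $g$ for which there are $d\ge 0$ and $c_1,\dots,c_d\in K$ with $g(n)=\sum_{i=1}^d c_i g(n-i)$ for all $n\ge d$. -}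

module Defs where

open import Level using (Level; _⊔_) renaming (suc to lsuc)
open import Algebra.Bundles using (CommutativeRing; Semiring)
open import Data.Nat using (ℕ; zero; suc; _≤_; _∸_) renaming (_^_ to _^ℕ_; _*_ to _*ℕ_; _+_ to _+ℕ_)
open import Data.Nat.Divisibility using (_∣_)
open import Data.Nat.Coprimality using (Coprime)
open import Data.Fin using (Fin; toℕ)
open import Data.Product using (Σ; ∃; _×_)
open import Relation.Nullary using (¬_)

record Field (c ℓ : Level) : Set (lsuc (c ⊔ ℓ)) where
  field
    commutativeRing : CommutativeRing c ℓ
  open CommutativeRing commutativeRing public
  field
    0≉1     : ¬ (0# ≈ 1#)
    inverse : ∀ x → ¬ (x ≈ 0#) → ∃ λ y → x * y ≈ 1#

module FieldDefs {c ℓ : Level} (F : Field c ℓ) where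
  open Field F renaming (Carrier to K)
  open import Algebra.Definitions.RawSemiring (Semiring.rawSemiring semiring) public
    using (_^_; sum) renaming (_×_ to _⨰_)

  CharZero : Set ℓ
  CharZero = ∀ n → ¬ (suc n ⨰ 1# ≈ 0#)

  Multiplicative : (ℕ → K) → Set ℓ
  Multiplicative χ = ∀ m n → 1 ≤ m → 1 ≤ n → Coprime m n → χ (m *ℕ n) ≈ χ m * χ n

  EventuallyPeriodic : (ℕ → K) → Set ℓ
  EventuallyPeriodic χ = Σ ℕ λ N → Σ ℕ λ P → 1 ≤ P × (∀ n → N ≤ n → χ (n +ℕ P) ≈ χ n)

  -- linear recurrence: ∃ d, c₁..c_d with g(n) = Σ_{i=1}^d c_i g(n-i) for all n ≥ d
  -- (c (i : Fin d) plays the role of c_{i+1})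
  LinearRecurrence : (ℕ → K) → Set (c ⊔ ℓ)
  LinearRecurrence g = Σ ℕ λ d → Σ (Fin d → K) λ cs →
    ∀ n → d ≤ n → g n ≈ sum (λ i → cs i * g (n ∸ suc (toℕ i)))

  Representation : ℕ → (ℕ → K) → (ℕ → K) → ℕ → (ℕ → K) → Set (c ⊔ ℓ)
  Representation p f g r χ =
    LinearRecurrence g × g 0 ≈ 1# × Multiplicative χ × EventuallyPeriodic χ ×
    (∀ i m → 1 ≤ m → ¬ (p ∣ m) → f ((p ^ℕ i) *ℕ m) ≈ g i * ((m ⨰ 1#) ^ r * χ m))

  NonZeroFunction : (ℕ → K) → Set ℓ
  NonZeroFunction f = ∃ λ n → 1 ≤ n × ¬ (f n ≈ 0#)

  InfinitelyManyNonzeroCoprime : ℕ → (ℕ → K) → Set ℓ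
  InfinitelyManyNonzeroCoprime p f = ∀ N → ∃ λ n → N ≤ n × 1 ≤ n × ¬ (p ∣ n) × ¬ (f n ≈ 0#)

  VanishesOnMultiples : ℕ → (ℕ → K) → Set ℓ
  VanishesOnMultiples p χ = ∀ n → p ∣ n → χ n ≈ 0#

{-# OPTIONS --safe #-}
module Submission where

-- Evaluating a representation at arguments m with p ∤ m gives f(m) = m^r χ(m),
-- since g(0) = 1.  Writing a point where f does not vanish as p^i m, the factor
-- m^r χ(m) is nonzero, so g(j) = f(p^j m) / (m^r χ(m)) is determined by f.  For
-- the exponent, take n with p ∤ n and f(n) ≠ 0 beyond the preperiods of χ and χ′,
-- and shift it by T = p P P′ (P, P′ the periods): then n^r χ(n) = n^r′ χ′(n) and
-- (n+T)^r χ(n) = (n+T)^r′ χ′(n), so r < r′ would force n^(r′-r) = (n+T)^(r′-r)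
-- in K, impossible in characteristic 0.  Once r = r′, cancelling m^r identifies
-- χ and χ′ off the multiples of p, where both vanish by assumption.

open import Defs
open import Level using (Level)
open import Algebra.Bundles using (Semiring)
open import Data.Empty using (⊥-elim)
open import Data.Nat as ℕ using (ℕ; zero; suc; _≤_; _<_; _∸_; NonZero)
import Data.Nat.Properties as ℕₚ
open import Data.Nat.Divisibility
  using (_∣_; _∣?_; divides; divides-refl; ∣-trans; m∣m*n; n∣m*n; n∣m*n*o; ∣m+n∣m⇒∣n)
open import Data.Nat.Induction using (<-rec)
open import Data.Nat.Primality using (Prime; prime⇒nonTrivial)
open import Data.Product using (_×_; ∃₂; _,_; proj₁; proj₂)
open import Induction.WellFounded using (WfRec)
open import Relation.Binary.Bundles using (Setoid)
open import Relation.Binary.Definitions using (tri<; tri≈; tri>)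
open import Relation.Binary.PropositionalEquality as ≡ using (_≡_)
open import Relation.Nullary using (¬_; yes; no)

p-free-factorisation : ∀ {p} → 1 < p → ∀ n → 1 ≤ n →
  ∃₂ λ i m → 1 ≤ m × ¬ p ∣ m × n ≡ p ℕ.^ i ℕ.* m
p-free-factorisation {p} 1<p = <-rec Factorisable factorise
  where
  Factorisable : ℕ → Set
  Factorisable n = 1 ≤ n → ∃₂ λ i m → 1 ≤ m × ¬ p ∣ m × n ≡ p ℕ.^ i ℕ.* m

  factorise : ∀ n → WfRec _<_ Factorisable n → Factorisable n
  factorise n rec 1≤n with p ∣? n
  ... | no p∤n = 0 , n , 1≤n , p∤n , ≡.sym (ℕₚ.*-identityˡ n)
  ... | yes (divides zero n≡0) = ⊥-elim (ℕₚ.n>0⇒n≢0 1≤n n≡0)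
  ... | yes (divides q@(suc _) n≡q*p) = multiply-by-p (rec q<n (ℕ.s≤s ℕ.z≤n))
    where
    q<n : q < n
    q<n = ≡.subst (q <_) (≡.sym n≡q*p) (ℕₚ.m<m*n q p 1<p)

    multiply-by-p : ∃₂ (λ i m → 1 ≤ m × ¬ p ∣ m × q ≡ p ℕ.^ i ℕ.* m) →
      ∃₂ λ i m → 1 ≤ m × ¬ p ∣ m × n ≡ p ℕ.^ i ℕ.* m
    multiply-by-p (i , m , 1≤m , p∤m , q≡pⁱm) = suc i , m , 1≤m , p∤m , (begin
      n                       ≡⟨ n≡q*p ⟩
      q ℕ.* p                 ≡⟨ ℕₚ.*-comm q p ⟩
      p ℕ.* q                 ≡⟨ ≡.cong (p ℕ.*_) q≡pⁱm ⟩
      p ℕ.* (p ℕ.^ i ℕ.* m)   ≡⟨ ≡.sym (ℕₚ.*-assoc p (p ℕ.^ i) m) ⟩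
      p ℕ.^ suc i ℕ.* m       ∎)
      where open ≡.≡-Reasoning

module _ {a ℓ} (S : Setoid a ℓ) where
  open Setoid S
  open import Relation.Binary.Reasoning.Setoid S

  periodic-∣ : ∀ {h : ℕ → Carrier} {N P} → (∀ n → N ≤ n → h (n ℕ.+ P) ≈ h n) →
    ∀ {k} → P ∣ k → ∀ n → N ≤ n → h (n ℕ.+ k) ≈ h n
  periodic-∣ {h} per (divides-refl zero) n N≤n = reflexive (≡.cong h (ℕₚ.+-identityʳ n))
  periodic-∣ {h} {N} {P} per (divides-refl (suc q)) n N≤n = begin
    h (n ℕ.+ (P ℕ.+ q ℕ.* P))  ≡⟨ ≡.cong h (≡.sym (ℕₚ.+-assoc n P (q ℕ.* P))) ⟩
    h (n ℕ.+ P ℕ.+ q ℕ.* P)    ≈⟨ periodic-∣ per (divides-refl q) (n ℕ.+ P) N≤n+P ⟩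
    h (n ℕ.+ P)                ≈⟨ per n N≤n ⟩
    h n                        ∎
    where
    N≤n+P : N ≤ n ℕ.+ P
    N≤n+P = ℕₚ.≤-trans N≤n (ℕₚ.m≤m+n n P)

module _ {a ℓ} (S : Semiring a ℓ) where
  open Semiring S
  open import Algebra.Definitions.RawSemiring rawSemiring using (_^_) renaming (_×_ to _⨰_)
  open import Algebra.Properties.Semiring.Mult S using (×1-homo-*)
  open import Relation.Binary.Reasoning.Setoid setoid

  ×1-homo-^ : ∀ n s → (n ⨰ 1#) ^ s ≈ (n ℕ.^ s) ⨰ 1#
  ×1-homo-^ n zero = sym (+-identityʳ 1#)
  ×1-homo-^ n (suc s) = begin
    (n ⨰ 1#) * (n ⨰ 1#) ^ s        ≈⟨ *-congˡ (×1-homo-^ n s) ⟩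
    (n ⨰ 1#) * ((n ℕ.^ s) ⨰ 1#)   ≈⟨ ×1-homo-* n (n ℕ.^ s) ⟨
    (n ℕ.* n ℕ.^ s) ⨰ 1#          ∎

module FieldProperties {c ℓ} (F : Field c ℓ) where
  open Field F renaming (Carrier to K)
  open FieldDefs F
  open import Algebra.Properties.Group +-group using () renaming (∙-cancelˡ to +-cancelˡ)
  open import Algebra.Properties.Semiring.Exp semiring using (^-congʳ; ^-homo-*)
  open import Relation.Binary.Reasoning.Setoid setoid

  *-cancelˡ-≉0 : ∀ {x y z} → x ≉ 0# → x * y ≈ x * z → y ≈ z
  *-cancelˡ-≉0 {x} {y} {z} x≉0 xy≈xz with x⁻¹ , xx⁻¹≈1 ← inverse x x≉0 = begin
    y                 ≈⟨ *-identityˡ y ⟨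
    1# * y            ≈⟨ *-congʳ x⁻¹x≈1 ⟨
    (x⁻¹ * x) * y     ≈⟨ *-assoc x⁻¹ x y ⟩
    x⁻¹ * (x * y)     ≈⟨ *-congˡ xy≈xz ⟩
    x⁻¹ * (x * z)     ≈⟨ *-assoc x⁻¹ x z ⟨
    (x⁻¹ * x) * z     ≈⟨ *-congʳ x⁻¹x≈1 ⟩
    1# * z            ≈⟨ *-identityˡ z ⟩
    z                 ∎
    where
    x⁻¹x≈1 : x⁻¹ * x ≈ 1#
    x⁻¹x≈1 = trans (*-comm x⁻¹ x) xx⁻¹≈1

  *-cancelʳ-≉0 : ∀ {x y z} → x ≉ 0# → y * x ≈ z * x → y ≈ z
  *-cancelʳ-≉0 {x} {y} {z} x≉0 yx≈zx =
    *-cancelˡ-≉0 x≉0 (trans (*-comm x y) (trans yx≈zx (*-comm z x)))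

  x*y≉0⇒y≉0 : ∀ {x y} → x * y ≉ 0# → y ≉ 0#
  x*y≉0⇒y≉0 {x} xy≉0 y≈0 = xy≉0 (trans (*-congˡ y≈0) (zeroʳ x))

  *-≉0 : ∀ {x y} → x ≉ 0# → y ≉ 0# → x * y ≉ 0#
  *-≉0 {x} x≉0 y≉0 xy≈0 = y≉0 (*-cancelˡ-≉0 x≉0 (trans xy≈0 (sym (zeroʳ x))))

  ^-≉0 : ∀ {x} → x ≉ 0# → ∀ n → x ^ n ≉ 0#
  ^-≉0 x≉0 zero    1≈0 = 0≉1 (sym 1≈0)
  ^-≉0 x≉0 (suc n) = *-≉0 x≉0 (^-≉0 x≉0 n)

  ^-cancel-≉0 : ∀ {c x y r r′} → r ≤ r′ → c ≉ 0# →
    c ^ r * x ≈ c ^ r′ * y → x ≈ c ^ (r′ ∸ r) * y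
  ^-cancel-≉0 {c} {x} {y} {r} {r′} r≤r′ c≉0 eq = *-cancelˡ-≉0 (^-≉0 c≉0 r) (begin
    c ^ r * x                      ≈⟨ eq ⟩
    c ^ r′ * y                     ≈⟨ *-congʳ (^-congʳ c (≡.sym (ℕₚ.m+[n∸m]≡n r≤r′))) ⟩
    c ^ (r ℕ.+ (r′ ∸ r)) * y       ≈⟨ *-congʳ (^-homo-* c r (r′ ∸ r)) ⟩
    c ^ r * c ^ (r′ ∸ r) * y       ≈⟨ *-assoc _ _ y ⟩
    c ^ r * (c ^ (r′ ∸ r) * y)     ∎)

  module CharacteristicZero (char0 : CharZero) where

    ×1-injective : ∀ {m n} → m ⨰ 1# ≈ n ⨰ 1# → m ≡ n
    ×1-injective {zero}  {zero}  _  = ≡.refl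
    ×1-injective {zero}  {suc n} eq = ⊥-elim (char0 n (sym eq))
    ×1-injective {suc m} {zero}  eq = ⊥-elim (char0 m eq)
    ×1-injective {suc m} {suc n} eq = ≡.cong suc (×1-injective (+-cancelˡ 1# _ _ eq))

    ×1-≉0 : ∀ {n} → 1 ≤ n → n ⨰ 1# ≉ 0#
    ×1-≉0 {suc n} _ = char0 n

    exponent-gap-impossible : ∀ {a b r r′ x y} → r < r′ → 1 ≤ a → a < b → y ≉ 0# →
      (a ⨰ 1#) ^ r * x ≈ (a ⨰ 1#) ^ r′ * y → ¬ (b ⨰ 1#) ^ r * x ≈ (b ⨰ 1#) ^ r′ * y
    exponent-gap-impossible {a} {b} {r} {r′} {x} {y} r<r′ 1≤a a<b y≉0 eqa eqb =
      ℕₚ.<⇒≢ (ℕₚ.^-monoˡ-< s a<b) (×1-injective (begin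
        (a ℕ.^ s) ⨰ 1#   ≈⟨ ×1-homo-^ semiring a s ⟨
        (a ⨰ 1#) ^ s     ≈⟨ *-cancelʳ-≉0 y≉0 (trans (sym x≈aˢy) x≈bˢy) ⟩
        (b ⨰ 1#) ^ s     ≈⟨ ×1-homo-^ semiring b s ⟩
        (b ℕ.^ s) ⨰ 1#   ∎))
      where
      s = r′ ∸ r
      instance
        s≢0 : NonZero s
        s≢0 = ℕ.>-nonZero (ℕₚ.m<n⇒0<n∸m r<r′)
      x≈aˢy : x ≈ (a ⨰ 1#) ^ s * y
      x≈aˢy = ^-cancel-≉0 (ℕₚ.<⇒≤ r<r′) (×1-≉0 1≤a) eqa
      x≈bˢy : x ≈ (b ⨰ 1#) ^ s * y
      x≈bˢy = ^-cancel-≉0 (ℕₚ.<⇒≤ r<r′) (×1-≉0 (ℕₚ.≤-trans 1≤a (ℕₚ.<⇒≤ a<b))) eqb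

    monomial-exponent-unique : ∀ {a b r r′ x y} → 1 ≤ a → a < b → x ≉ 0# → y ≉ 0# →
      (a ⨰ 1#) ^ r * x ≈ (a ⨰ 1#) ^ r′ * y → (b ⨰ 1#) ^ r * x ≈ (b ⨰ 1#) ^ r′ * y → r ≡ r′
    monomial-exponent-unique {r = r} {r′} 1≤a a<b x≉0 y≉0 eqa eqb with ℕₚ.<-cmp r r′
    ... | tri< r<r′ _ _ = ⊥-elim (exponent-gap-impossible r<r′ 1≤a a<b y≉0 eqa eqb)
    ... | tri≈ _ r≡r′ _ = r≡r′
    ... | tri> _ _ r′<r = ⊥-elim (exponent-gap-impossible r′<r 1≤a a<b x≉0 (sym eqa) (sym eqb))

module Representations {c ℓ} (F : Field c ℓ) (p : ℕ) (f : ℕ → Field.Carrier F) where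
  open Field F renaming (Carrier to K)
  open FieldDefs F
  open FieldProperties F
  open import Relation.Binary.Reasoning.Setoid setoid

  twistedPower : ℕ → (ℕ → K) → ℕ → K
  twistedPower r χ m = (m ⨰ 1#) ^ r * χ m

  module Evaluation {g r χ} (R : Representation p f g r χ) where

    g0≈1 : g 0 ≈ 1#
    g0≈1 = proj₁ (proj₂ R)

    χ-eventuallyPeriodic : EventuallyPeriodic χ
    χ-eventuallyPeriodic = proj₁ (proj₂ (proj₂ (proj₂ R)))

    f-at-p-power : ∀ i m → 1 ≤ m → ¬ p ∣ m → f (p ℕ.^ i ℕ.* m) ≈ g i * twistedPower r χ m
    f-at-p-power = proj₂ (proj₂ (proj₂ (proj₂ R)))

    f≈twistedPower : ∀ m → 1 ≤ m → ¬ p ∣ m → f m ≈ twistedPower r χ m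
    f≈twistedPower m 1≤m p∤m = begin
      f m                          ≡⟨ ≡.cong f (ℕₚ.*-identityˡ m) ⟨
      f (p ℕ.^ 0 ℕ.* m)            ≈⟨ f-at-p-power 0 m 1≤m p∤m ⟩
      g 0 * twistedPower r χ m     ≈⟨ *-congʳ g0≈1 ⟩
      1# * twistedPower r χ m      ≈⟨ *-identityˡ _ ⟩
      twistedPower r χ m           ∎

    twistedPower≉0 : ∀ {m} → 1 ≤ m → ¬ p ∣ m → f m ≉ 0# → twistedPower r χ m ≉ 0#
    twistedPower≉0 {m} 1≤m p∤m fm≉0 tm≈0 = fm≉0 (trans (f≈twistedPower m 1≤m p∤m) tm≈0)

  module Comparison {g r χ g′ r′ χ′}
    (R : Representation p f g r χ) (R′ : Representation p f g′ r′ χ′) where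
    open Evaluation {g} {r} {χ} R
    open Evaluation {g′} {r′} {χ′} R′ using () renaming
      (χ-eventuallyPeriodic to χ′-eventuallyPeriodic; f-at-p-power to f-at-p-power′;
       f≈twistedPower to f≈twistedPower′; twistedPower≉0 to twistedPower′≉0)

    twistedPowers-agree : ∀ m → 1 ≤ m → ¬ p ∣ m → twistedPower r χ m ≈ twistedPower r′ χ′ m
    twistedPowers-agree m 1≤m p∤m = trans (sym (f≈twistedPower m 1≤m p∤m)) (f≈twistedPower′ m 1≤m p∤m)

    g-unique : 1 < p → NonZeroFunction f → ∀ j → g j ≈ g′ j
    g-unique 1<p (n , 1≤n , fn≉0) j
      with i , m , 1≤m , p∤m , n≡pⁱm ← p-free-factorisation 1<p n 1≤n
      = *-cancelʳ-≉0 tm≉0 (begin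
        g j * twistedPower r χ m       ≈⟨ f-at-p-power j m 1≤m p∤m ⟨
        f (p ℕ.^ j ℕ.* m)              ≈⟨ f-at-p-power′ j m 1≤m p∤m ⟩
        g′ j * twistedPower r′ χ′ m    ≈⟨ *-congˡ (twistedPowers-agree m 1≤m p∤m) ⟨
        g′ j * twistedPower r χ m      ∎)
      where
      tm≉0 : twistedPower r χ m ≉ 0#
      tm≉0 = x*y≉0⇒y≉0 λ gᵢtm≈0 →
        fn≉0 (trans (reflexive (≡.cong f n≡pⁱm)) (trans (f-at-p-power i m 1≤m p∤m) gᵢtm≈0))

    module _ (char0 : CharZero) where
      open CharacteristicZero char0

      r-unique-by-shift : ∀ {n T} → 1 ≤ n → ¬ p ∣ n → f n ≉ 0# → 1 ≤ T → p ∣ T →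
        χ (n ℕ.+ T) ≈ χ n → χ′ (n ℕ.+ T) ≈ χ′ n → r ≡ r′
      r-unique-by-shift {n} {T} 1≤n p∤n fn≉0 1≤T p∣T χ-shift χ′-shift =
        monomial-exponent-unique 1≤n (ℕₚ.m<m+n n 1≤T)
          (x*y≉0⇒y≉0 (twistedPower≉0 1≤n p∤n fn≉0))
          (x*y≉0⇒y≉0 (twistedPower′≉0 1≤n p∤n fn≉0))
          (twistedPowers-agree n 1≤n p∤n) agree-at-n+T
        where
        p∤n+T : ¬ p ∣ n ℕ.+ T
        p∤n+T p∣n+T = p∤n (∣m+n∣m⇒∣n (≡.subst (p ∣_) (ℕₚ.+-comm n T) p∣n+T) p∣T)
        1≤n+T : 1 ≤ n ℕ.+ T
        1≤n+T = ℕₚ.≤-trans 1≤n (ℕₚ.m≤m+n n T)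
        agree-at-n+T : ((n ℕ.+ T) ⨰ 1#) ^ r * χ n ≈ ((n ℕ.+ T) ⨰ 1#) ^ r′ * χ′ n
        agree-at-n+T = begin
          ((n ℕ.+ T) ⨰ 1#) ^ r * χ n     ≈⟨ *-congˡ χ-shift ⟨
          twistedPower r χ (n ℕ.+ T)     ≈⟨ twistedPowers-agree _ 1≤n+T p∤n+T ⟩
          twistedPower r′ χ′ (n ℕ.+ T)   ≈⟨ *-congˡ χ′-shift ⟩
          ((n ℕ.+ T) ⨰ 1#) ^ r′ * χ′ n   ∎

      r-unique : 0 < p → InfinitelyManyNonzeroCoprime p f → r ≡ r′
      r-unique 0<p nonzero
        with N , P , 1≤P , per ← χ-eventuallyPeriodic
           | N′ , P′ , 1≤P′ , per′ ← χ′-eventuallyPeriodic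
        with n , N+N′≤n , 1≤n , p∤n , fn≉0 ← nonzero (N ℕ.+ N′)
        = r-unique-by-shift 1≤n p∤n fn≉0
            (ℕₚ.*-mono-≤ (ℕₚ.*-mono-≤ 0<p 1≤P) 1≤P′)
            (∣-trans (m∣m*n P) (m∣m*n P′))
            (periodic-∣ setoid per (n∣m*n*o p P′) n (ℕₚ.≤-trans (ℕₚ.m≤m+n N N′) N+N′≤n))
            (periodic-∣ setoid per′ (n∣m*n (p ℕ.* P)) n (ℕₚ.≤-trans (ℕₚ.m≤n+m N′ N) N+N′≤n))

      χ-unique : r ≡ r′ → VanishesOnMultiples p χ → VanishesOnMultiples p χ′ →
        ∀ n → 1 ≤ n → χ n ≈ χ′ n
      χ-unique ≡.refl van van′ n 1≤n with p ∣? n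
      ... | yes p∣n = trans (van n p∣n) (sym (van′ n p∣n))
      ... | no p∤n = *-cancelˡ-≉0 (^-≉0 (×1-≉0 1≤n) r) (twistedPowers-agree n 1≤n p∤n)

proposition3p5 : ∀ {c ℓ : Level} (F : Field c ℓ) → FieldDefs.CharZero F →
    (p : ℕ) → Prime p → (f : ℕ → Field.Carrier F) →
    ∀ (g : ℕ → Field.Carrier F) (r : ℕ) (χ : ℕ → Field.Carrier F)
      (g′ : ℕ → Field.Carrier F) (r′ : ℕ) (χ′ : ℕ → Field.Carrier F) →
    FieldDefs.Representation F p f g r χ →
    FieldDefs.Representation F p f g′ r′ χ′ →
    (FieldDefs.NonZeroFunction F f → ∀ i → Field._≈_ F (g i) (g′ i)) ×
    (FieldDefs.InfinitelyManyNonzeroCoprime F p f →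
      FieldDefs.VanishesOnMultiples F p χ → FieldDefs.VanishesOnMultiples F p χ′ →
      r ≡ r′ × (∀ n → 1 ≤ n → Field._≈_ F (χ n) (χ′ n)))
proposition3p5 F char0 p prime f g r χ g′ r′ χ′ R R′ =
  g-unique 1<p ,
  λ nonzero van van′ →
    let r≡r′ = r-unique char0 (ℕₚ.<⇒≤ 1<p) nonzero
    in r≡r′ , χ-unique char0 r≡r′ van van′
  where
  open Representations.Comparison F p f {g} {r} {χ} {g′} {r′} {χ′} R R′
  1<p : 1 < p
  1<p = ℕ.nonTrivial⇒n>1 p {{prime⇒nonTrivial prime}}
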